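{- Let $C$ be a Greene–Kleitman chain of length $h$ in $Q_n$ and let $C'$ be a child of $C$ obtained by matching two $*$s at positions $a,b$. Then there are exactly $h-2$ flipping 4-cycles between $C$ and $C'$; they use pairwise distinct edges of $C$ and pairwise distinct edges of $C'$, and the edges of $C$ they use are all edges of $C$ except the two consecutive edges of $C$ that flip the coordinates $a$ and $b$.
   Context: $Q_n$: vertices are bitstrings of length $n$, adjacent if they differ in one bit. $D$ is the set of bitstrings (including the empty string) with equally many 0s and 1s such that every prefix has at least as many 0s as 1s. A Greene–Kleitman chain is a string $C=u_0*u_1*\cdots*u_h$ of length $n$ over $\{0,1,*\}$ with $u_0,\ldots,u_h\in D$; its length is $h$, and it represents the path in $Q_n$ with vertices obtained by replacing the $*$s by $i$ ones followed by $h-i$ zeros, $i=0,\ldots,h$ (consecutive vertices differ in one bit). A chain $C'$ of length $h-2$ is a child of $C$ if $C'$ is obtained from $C$ by replacing two consecutive $*$s of $C$ (the $j$-th and $(j+1)$-st $*$ for some $j$), located at positions $a<b$, by $0$ and $1$ respectively (matching these two $*$s). A flipping 4-cycle between two vertex-disjoint paths $P,P'$ is a 4-cycle of $Q_n$ that shares exactly one edge with each of $P$ and $P'$. -}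

module Defs where

open import Data.Nat using (ℕ; zero; suc; _≤_; _<_; _∸_)
open import Data.Bool using (Bool; true; false)
open import Data.Fin using (Fin; zero; suc) renaming (_<_ to _<ᶠ_)
open import Data.Vec using (Vec; []; _∷_; lookup; toList)
open import Data.List using (List; []; _∷_; take)
open import Data.List.Relation.Unary.All using (All)
open import Data.Product using (Σ; ∃; _×_; _,_)
open import Data.Sum using (_⊎_)
open import Relation.Binary.PropositionalEquality using (_≡_; _≢_)
open import Relation.Nullary using (¬_)

Vertex : ℕ → Set
Vertex n = Vec Bool n

Adj : ∀ {n} → Vertex n → Vertex n → Set
Adj {n} u v = Σ (Fin n) λ p → (lookup u p ≢ lookup v p) ×
                 (∀ q → lookup u q ≢ lookup v q → q ≡ p)

Edge : ℕ → Set
Edge n = Vertex n × Vertex n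

SameEdge : ∀ {n} → Edge n → Edge n → Set
SameEdge (u , v) (u' , v') = (u ≡ u' × v ≡ v') ⊎ (u ≡ v' × v ≡ u')

data Sym : Set where
  s0 s1 star : Sym

cnt0 cnt1 : List Sym → ℕ
cnt0 [] = 0
cnt0 (s0 ∷ w) = suc (cnt0 w)
cnt0 (_ ∷ w) = cnt0 w
cnt1 [] = 0
cnt1 (s1 ∷ w) = suc (cnt1 w)
cnt1 (_ ∷ w) = cnt1 w

IsD : List Sym → Set
IsD w = All (λ x → x ≢ star) w × (cnt0 w ≡ cnt1 w) ×
        (∀ k → cnt1 (take k w) ≤ cnt0 (take k w))

-- split a string at its stars: u_0 * u_1 * ... * u_h  ↦  (u_0 , [u_1 ,..., u_h])
splitStars : List Sym → List Sym × List (List Sym)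
splitStars [] = [] , []
splitStars (star ∷ w) with splitStars w
... | u , us = [] , (u ∷ us)
splitStars (c ∷ w) with splitStars w
... | u , us = (c ∷ u) , us

IsGK : ∀ {n} → Vec Sym n → Set
IsGK C with splitStars (toList C)
... | u , us = IsD u × All IsD us

-- number of stars = length h of the chain
stars : ∀ {n} → Vec Sym n → ℕ
stars [] = 0
stars (star ∷ C) = suc (stars C)
stars (_ ∷ C) = stars C

fill : ∀ {n} → ℕ → Vec Sym n → Vertex n
fill m [] = []
fill m (s0 ∷ C) = false ∷ fill m C
fill m (s1 ∷ C) = true ∷ fill m C
fill zero (star ∷ C) = false ∷ fill zero C
fill (suc m) (star ∷ C) = true ∷ fill m C

-- the i-th vertex (0 ≤ i ≤ h) of the path represented by C
pathVertex : ∀ {n} → Vec Sym n → ℕ → Vertex n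
pathVertex C i = fill i C

pathEdge : ∀ {n} → Vec Sym n → ℕ → Edge n
pathEdge C i = pathVertex C i , pathVertex C (suc i)

OnPath : ∀ {n} → Vec Sym n → Edge n → Set
OnPath C e = ∃ λ i → (i < stars C) × SameEdge e (pathEdge C i)

FlipsAt : ∀ {n} → Vec Sym n → ℕ → Fin n → Set
FlipsAt C i p = lookup (pathVertex C i) p ≢ lookup (pathVertex C (suc i)) p

IsChild : ∀ {n} → Vec Sym n → Vec Sym n → Fin n → Fin n → Set
IsChild {n} C C' a b =
  (a <ᶠ b) × (lookup C a ≡ star) × (lookup C b ≡ star) ×
  (∀ (k : Fin n) → a <ᶠ k → k <ᶠ b → lookup C k ≢ star) ×
  (lookup C' a ≡ s0) × (lookup C' b ≡ s1) ×
  (∀ (k : Fin n) → k ≢ a → k ≢ b → lookup C' k ≡ lookup C k)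

next4 : Fin 4 → Fin 4
next4 zero = suc zero
next4 (suc zero) = suc (suc zero)
next4 (suc (suc zero)) = suc (suc (suc zero))
next4 (suc (suc (suc zero))) = zero

record Cycle4 (n : ℕ) : Set where
  field
    vtx      : Fin 4 → Vertex n
    distinct : ∀ i j → vtx i ≡ vtx j → i ≡ j
    adj      : ∀ i → Adj (vtx i) (vtx (next4 i))
open Cycle4 public

cycEdge : ∀ {n} → Cycle4 n → Fin 4 → Edge n
cycEdge Z k = vtx Z k , vtx Z (next4 k)

SameCycle : ∀ {n} → Cycle4 n → Cycle4 n → Set
SameCycle Z W = (∀ k → ∃ λ k' → SameEdge (cycEdge Z k) (cycEdge W k')) ×
                (∀ k → ∃ λ k' → SameEdge (cycEdge W k) (cycEdge Z k'))

SharesOneEdge : ∀ {n} → Vec Sym n → Cycle4 n → Set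
SharesOneEdge C Z = Σ (Fin 4) λ k → OnPath C (cycEdge Z k) ×
                     (∀ k' → OnPath C (cycEdge Z k') → k' ≡ k)

Flipping : ∀ {n} → Vec Sym n → Vec Sym n → Cycle4 n → Set
Flipping C C' Z = SharesOneEdge C Z × SharesOneEdge C' Z

UsesEdge : ∀ {n} → Vec Sym n → Cycle4 n → ℕ → Set
UsesEdge C Z i = (i < stars C) × ∃ λ k → SameEdge (cycEdge Z k) (pathEdge C i)

-- Write P x and Q y for the vertices of C and C', and j for the number of stars of C before
-- position a. Turning the stars at a and b into 0 and 1 gives Q y = P y with bit b flipped for
-- y ≤ j, and Q y = P (y + 2) with bit a flipped for y ≥ j; comparing bits a and b shows that the
-- two paths are disjoint and that P x ~ Q y only in these two situations. A 4-cycle sharing one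
-- edge with each path has them as opposite sides, so it is the square P i, P (i+1), Q (m+1), Q m
-- with i = m for m < j and i = m + 2 for m ≥ j: one square for each of the h - 2 edges of C',
-- using every edge of C except the j-th and (j+1)-st, which flip a and b.

module Submission where

open import Defs
open import Data.Bool using (true; false; not)
import Data.Bool as Bool
open import Data.Bool.Properties using (not-¬; ¬-not)
open import Data.Empty using (⊥; ⊥-elim)
open import Data.Fin using (Fin; zero; suc; toℕ; fromℕ<) renaming (_<_ to _<ᶠ_)
open import Data.Fin.Patterns using (0F; 1F; 2F; 3F)
import Data.Fin.Properties as Fin
open import Data.Nat using (ℕ; zero; suc; _≤_; _<_; _∸_; z≤n; s≤s; _≤?_; _<?_)
open import Data.Nat.Properties
  using (≤-reflexive; ≤-trans; ≤-pred; <⇒≤; <⇒≢; >⇒≢; ≰⇒>; ≮⇒≥; ≤∧≢⇒<; <⇒≱; <-cmp; <-trans; <-asym;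
         m≤n⇒m≤1+n; m<n⇒m<1+n; n<1+n; n≤1+n; 1+n≢n; suc-injective)
open import Data.Product using (Σ; ∃; _×_; _,_; proj₁; proj₂)
import Data.Product as Product
open import Data.Sum using (_⊎_; inj₁; inj₂)
open import Data.Vec using (Vec; []; _∷_; lookup; updateAt; _[_]≔_; tabulate)
open import Data.Vec.Properties
  using (lookup∘updateAt; lookup∘updateAt′; lookup∘update; lookup∘update′; tabulate∘lookup;
         tabulate-cong; ∷-injectiveʳ)
open import Function.Base using (_∘_)
open import Function.Bundles using (_⇔_; mk⇔; Equivalence)
open import Relation.Binary.Definitions using (tri<; tri≈; tri>)
open import Relation.Binary.PropositionalEquality
open import Relation.Nullary using (¬_; yes; no)
open import Relation.Nullary.Decidable using (toWitness; _⊎-dec_)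

private
  variable
    n : ℕ

lookup-ext : ∀ {A : Set} {u v : Vec A n} → (∀ p → lookup u p ≡ lookup v p) → u ≡ v
lookup-ext {u = u} {v} eq =
  trans (sym (tabulate∘lookup u)) (trans (tabulate-cong eq) (tabulate∘lookup v))

-- Adjacency in the hypercube

toggle : Fin n → Vertex n → Vertex n
toggle p u = updateAt u p not

Adj-toggle : ∀ p (u : Vertex n) → Adj u (toggle p u)
Adj-toggle p u = p , differs , only-p
  where
  differs : lookup u p ≢ lookup (toggle p u) p
  differs eq = not-¬ refl (trans eq (lookup∘updateAt p u))
  only-p : ∀ q → lookup u q ≢ lookup (toggle p u) q → q ≡ p
  only-p q differs-q with q Fin.≟ p
  ... | yes q≡p = q≡p
  ... | no q≢p = ⊥-elim (differs-q (sym (lookup∘updateAt′ q p q≢p u)))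

Adj-sym : {u v : Vertex n} → Adj u v → Adj v u
Adj-sym (p , differs , only) = p , (differs ∘ sym) , λ q differs-q → only q (differs-q ∘ sym)

Adj-coordinate-unique : ∀ {u v : Vertex n} {p q} → Adj u v →
                        lookup u p ≢ lookup v p → lookup u q ≢ lookup v q → p ≡ q
Adj-coordinate-unique (_ , _ , only) differs-p differs-q = trans (only _ differs-p) (sym (only _ differs-q))

Adj⇒toggle : ∀ {u v : Vertex n} p → Adj u v → lookup u p ≢ lookup v p → v ≡ toggle p u
Adj⇒toggle {u = u} {v} p A differs-p = lookup-ext pointwise
  where
  pointwise : ∀ q → lookup v q ≡ lookup (toggle p u) q
  pointwise q with q Fin.≟ p | lookup u q Bool.≟ lookup v q
  ... | yes refl | _ = trans (¬-not (differs-p ∘ sym)) (sym (lookup∘updateAt q u))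
  ... | no q≢p | yes same = trans (sym same) (sym (lookup∘updateAt′ q p q≢p u))
  ... | no q≢p | no differs-q = ⊥-elim (q≢p (Adj-coordinate-unique {u = u} {v} A differs-q differs-p))

-- 4-cycles as vertex sequences

quad : ∀ {A : Set} → A → A → A → A → Fin 4 → A
quad u₀ u₁ u₂ u₃ 0F = u₀
quad u₀ u₁ u₂ u₃ 1F = u₁
quad u₀ u₁ u₂ u₃ 2F = u₂
quad u₀ u₁ u₂ u₃ 3F = u₃

quad-η : ∀ {A : Set} (f : Fin 4 → A) k → f k ≡ quad (f 0F) (f 1F) (f 2F) (f 3F) k
quad-η f 0F = refl
quad-η f 1F = refl
quad-η f 2F = refl
quad-η f 3F = refl

quad-injective : ∀ {A : Set} {u₀ u₁ u₂ u₃ : A} →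
                 u₀ ≢ u₁ → u₀ ≢ u₂ → u₀ ≢ u₃ → u₁ ≢ u₂ → u₁ ≢ u₃ → u₂ ≢ u₃ →
                 ∀ r s → quad u₀ u₁ u₂ u₃ r ≡ quad u₀ u₁ u₂ u₃ s → r ≡ s
quad-injective _   _   _   _   _   _   0F 0F _ = refl
quad-injective _   _   _   _   _   _   1F 1F _ = refl
quad-injective _   _   _   _   _   _   2F 2F _ = refl
quad-injective _   _   _   _   _   _   3F 3F _ = refl
quad-injective ≢01 _   _   _   _   _   0F 1F e = ⊥-elim (≢01 e)
quad-injective _   ≢02 _   _   _   _   0F 2F e = ⊥-elim (≢02 e)
quad-injective _   _   ≢03 _   _   _   0F 3F e = ⊥-elim (≢03 e)
quad-injective ≢01 _   _   _   _   _   1F 0F e = ⊥-elim (≢01 (sym e))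
quad-injective _   _   _   ≢12 _   _   1F 2F e = ⊥-elim (≢12 e)
quad-injective _   _   _   _   ≢13 _   1F 3F e = ⊥-elim (≢13 e)
quad-injective _   ≢02 _   _   _   _   2F 0F e = ⊥-elim (≢02 (sym e))
quad-injective _   _   _   ≢12 _   _   2F 1F e = ⊥-elim (≢12 (sym e))
quad-injective _   _   _   _   _   ≢23 2F 3F e = ⊥-elim (≢23 e)
quad-injective _   _   ≢03 _   _   _   3F 0F e = ⊥-elim (≢03 (sym e))
quad-injective _   _   _   _   ≢13 _   3F 1F e = ⊥-elim (≢13 (sym e))
quad-injective _   _   _   _   _   ≢23 3F 2F e = ⊥-elim (≢23 (sym e))

next4-period : ∀ k → next4 (next4 (next4 (next4 k))) ≡ k
next4-period = toWitness {a? = Fin.all? λ k → next4 (next4 (next4 (next4 k))) Fin.≟ k} _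

edges-adjacent-or-opposite : ∀ k k′ → k′ ≡ k ⊎ k′ ≡ next4 k ⊎ k ≡ next4 k′ ⊎ k′ ≡ next4 (next4 k)
edges-adjacent-or-opposite = toWitness {a? = Fin.all? λ k → Fin.all? λ k′ →
  (k′ Fin.≟ k) ⊎-dec (k′ Fin.≟ next4 k) ⊎-dec (k Fin.≟ next4 k′) ⊎-dec (k′ Fin.≟ next4 (next4 k))} _

SameEdge-refl : {u v : Vertex n} → SameEdge (u , v) (u , v)
SameEdge-refl = inj₁ (refl , refl)

SameEdge-swap : {u v : Vertex n} → SameEdge (u , v) (v , u)
SameEdge-swap = inj₂ (refl , refl)

SameEdge-sym : {e e′ : Edge n} → SameEdge e e′ → SameEdge e′ e
SameEdge-sym (inj₁ (refl , refl)) = SameEdge-refl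
SameEdge-sym (inj₂ (refl , refl)) = SameEdge-swap

SameEdge-trans : {e e′ e″ : Edge n} → SameEdge e e′ → SameEdge e′ e″ → SameEdge e e″
SameEdge-trans (inj₁ (refl , refl)) same = same
SameEdge-trans (inj₂ (refl , refl)) (inj₁ (refl , refl)) = SameEdge-swap
SameEdge-trans (inj₂ (refl , refl)) (inj₂ (refl , refl)) = SameEdge-refl

EdgesIn : (Fin 4 → Vertex n) → (Fin 4 → Vertex n) → Set
EdgesIn f g = ∀ k → ∃ λ k′ → SameEdge (f k , f (next4 k)) (g k′ , g (next4 k′))

SameEdges : (Fin 4 → Vertex n) → (Fin 4 → Vertex n) → Set
SameEdges f g = EdgesIn f g × EdgesIn g f

EdgesIn-trans : {f g h : Fin 4 → Vertex n} → EdgesIn f g → EdgesIn g h → EdgesIn f h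
EdgesIn-trans f⊆g g⊆h k with f⊆g k
... | k₁ , same₁ with g⊆h k₁
... | k₂ , same₂ = k₂ , SameEdge-trans same₁ same₂

SameEdges-refl : {f : Fin 4 → Vertex n} → SameEdges f f
SameEdges-refl = (λ k → k , SameEdge-refl) , (λ k → k , SameEdge-refl)

SameEdges-trans : {f g h : Fin 4 → Vertex n} → SameEdges f g → SameEdges g h → SameEdges f h
SameEdges-trans (f⊆g , g⊆f) (g⊆h , h⊆g) = EdgesIn-trans f⊆g g⊆h , EdgesIn-trans h⊆g g⊆f

SameEdges-η : (f : Fin 4 → Vertex n) → SameEdges f (quad (f 0F) (f 1F) (f 2F) (f 3F))
SameEdges-η f = (λ k → k , inj₁ (quad-η f k , quad-η f (next4 k)))
              , (λ k → k , inj₁ (sym (quad-η f k) , sym (quad-η f (next4 k))))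

EdgesIn-rotate : {u₀ u₁ u₂ u₃ : Vertex n} → EdgesIn (quad u₀ u₁ u₂ u₃) (quad u₁ u₂ u₃ u₀)
EdgesIn-rotate 0F = 3F , SameEdge-refl
EdgesIn-rotate 1F = 0F , SameEdge-refl
EdgesIn-rotate 2F = 1F , SameEdge-refl
EdgesIn-rotate 3F = 2F , SameEdge-refl

SameEdges-rotate : {u₀ u₁ u₂ u₃ : Vertex n} → SameEdges (quad u₀ u₁ u₂ u₃) (quad u₁ u₂ u₃ u₀)
SameEdges-rotate =
  EdgesIn-rotate , EdgesIn-trans EdgesIn-rotate (EdgesIn-trans EdgesIn-rotate EdgesIn-rotate)

EdgesIn-reverse : {u₀ u₁ u₂ u₃ : Vertex n} → EdgesIn (quad u₀ u₁ u₂ u₃) (quad u₁ u₀ u₃ u₂)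
EdgesIn-reverse 0F = 0F , SameEdge-swap
EdgesIn-reverse 1F = 3F , SameEdge-swap
EdgesIn-reverse 2F = 2F , SameEdge-swap
EdgesIn-reverse 3F = 1F , SameEdge-swap

SameEdges-reverse : {u₀ u₁ u₂ u₃ : Vertex n} → SameEdges (quad u₀ u₁ u₂ u₃) (quad u₁ u₀ u₃ u₂)
SameEdges-reverse = EdgesIn-reverse , EdgesIn-reverse

SameEdges-startAt : ∀ (f : Fin 4 → Vertex n) k →
  SameEdges f (quad (f k) (f (next4 k)) (f (next4 (next4 k))) (f (next4 (next4 (next4 k)))))
SameEdges-startAt f 0F = SameEdges-η f
SameEdges-startAt f 1F = SameEdges-trans (SameEdges-η f) SameEdges-rotate
SameEdges-startAt f 2F = SameEdges-trans (SameEdges-η f) (SameEdges-trans SameEdges-rotate SameEdges-rotate)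
SameEdges-startAt f 3F = SameEdges-trans (SameEdges-η f)
  (SameEdges-trans SameEdges-rotate (SameEdges-trans SameEdges-rotate SameEdges-rotate))

-- Filling the stars of a string

starsBefore : Vec Sym n → Fin n → ℕ
starsBefore (_ ∷ D) zero = 0
starsBefore (star ∷ D) (suc p) = suc (starsBefore D p)
starsBefore (s0 ∷ D) (suc p) = starsBefore D p
starsBefore (s1 ∷ D) (suc p) = starsBefore D p

starsBefore<stars : ∀ (D : Vec Sym n) {p} → lookup D p ≡ star → starsBefore D p < stars D
starsBefore<stars (star ∷ D) {zero} refl = s≤s z≤n
starsBefore<stars (s0 ∷ D) {suc p} Dp = starsBefore<stars D Dp
starsBefore<stars (s1 ∷ D) {suc p} Dp = starsBefore<stars D Dp
starsBefore<stars (star ∷ D) {suc p} Dp = s≤s (starsBefore<stars D Dp)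

starsBefore-none : ∀ (D : Vec Sym n) {p} → (∀ k → k <ᶠ p → lookup D k ≢ star) → starsBefore D p ≡ 0
starsBefore-none (_ ∷ D) {zero} _ = refl
starsBefore-none (s0 ∷ D) {suc p} none = starsBefore-none D (λ k k<p → none (suc k) (s≤s k<p))
starsBefore-none (s1 ∷ D) {suc p} none = starsBefore-none D (λ k k<p → none (suc k) (s≤s k<p))
starsBefore-none (star ∷ D) {suc p} none = ⊥-elim (none zero (s≤s z≤n) refl)

starsBefore-consecutive : ∀ (D : Vec Sym n) {a b} → a <ᶠ b → lookup D a ≡ star →
                          (∀ k → a <ᶠ k → k <ᶠ b → lookup D k ≢ star) →
                          starsBefore D b ≡ suc (starsBefore D a)
starsBefore-consecutive (star ∷ D) {zero} {suc b} _ refl none =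
  cong suc (starsBefore-none D (λ k k<b → none (suc k) (s≤s z≤n) (s≤s k<b)))
starsBefore-consecutive (s0 ∷ D) {suc a} {suc b} (s≤s a<b) Da none =
  starsBefore-consecutive D a<b Da (λ k a<k k<b → none (suc k) (s≤s a<k) (s≤s k<b))
starsBefore-consecutive (s1 ∷ D) {suc a} {suc b} (s≤s a<b) Da none =
  starsBefore-consecutive D a<b Da (λ k a<k k<b → none (suc k) (s≤s a<k) (s≤s k<b))
starsBefore-consecutive (star ∷ D) {suc a} {suc b} (s≤s a<b) Da none =
  cong suc (starsBefore-consecutive D a<b Da (λ k a<k k<b → none (suc k) (s≤s a<k) (s≤s k<b)))

stars-set : ∀ (D : Vec Sym n) {q c} → lookup D q ≡ star → c ≢ star → stars D ≡ suc (stars (D [ q ]≔ c))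
stars-set (star ∷ D) {zero} {s0} refl _ = refl
stars-set (star ∷ D) {zero} {s1} refl _ = refl
stars-set (star ∷ D) {zero} {star} refl c≢star = ⊥-elim (c≢star refl)
stars-set (s0 ∷ D) {suc q} Dq c≢star = stars-set D Dq c≢star
stars-set (s1 ∷ D) {suc q} Dq c≢star = stars-set D Dq c≢star
stars-set (star ∷ D) {suc q} Dq c≢star = cong suc (stars-set D Dq c≢star)

starsBefore-set : ∀ (D : Vec Sym n) {q p c} → q <ᶠ p → lookup D q ≡ star → c ≢ star →
                  starsBefore D p ≡ suc (starsBefore (D [ q ]≔ c) p)
starsBefore-set (star ∷ D) {zero} {suc p} {s0} _ refl _ = refl
starsBefore-set (star ∷ D) {zero} {suc p} {s1} _ refl _ = refl
starsBefore-set (star ∷ D) {zero} {suc p} {star} _ refl c≢star = ⊥-elim (c≢star refl)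
starsBefore-set (s0 ∷ D) {suc q} {suc p} (s≤s q<p) Dq c≢star = starsBefore-set D q<p Dq c≢star
starsBefore-set (s1 ∷ D) {suc q} {suc p} (s≤s q<p) Dq c≢star = starsBefore-set D q<p Dq c≢star
starsBefore-set (star ∷ D) {suc q} {suc p} (s≤s q<p) Dq c≢star = cong suc (starsBefore-set D q<p Dq c≢star)

fill-injective : ∀ (D : Vec Sym n) {x y} → x ≤ stars D → y ≤ stars D → fill x D ≡ fill y D → x ≡ y
fill-injective [] z≤n z≤n _ = refl
fill-injective (s0 ∷ D) x≤h y≤h e = fill-injective D x≤h y≤h (∷-injectiveʳ e)
fill-injective (s1 ∷ D) x≤h y≤h e = fill-injective D x≤h y≤h (∷-injectiveʳ e)
fill-injective (star ∷ D) {zero} {zero} _ _ _ = refl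
fill-injective (star ∷ D) {zero} {suc y} _ _ ()
fill-injective (star ∷ D) {suc x} {zero} _ _ ()
fill-injective (star ∷ D) {suc x} {suc y} (s≤s x≤h) (s≤s y≤h) e =
  cong suc (fill-injective D x≤h y≤h (∷-injectiveʳ e))

fill-suc : ∀ (D : Vec Sym n) {x} → x < stars D → ∃ λ p → fill (suc x) D ≡ toggle p (fill x D)
fill-suc (s0 ∷ D) x<h = Product.map suc (cong (false ∷_)) (fill-suc D x<h)
fill-suc (s1 ∷ D) x<h = Product.map suc (cong (true ∷_)) (fill-suc D x<h)
fill-suc (star ∷ D) {zero} _ = zero , refl
fill-suc (star ∷ D) {suc x} (s≤s x<h) = Product.map suc (cong (true ∷_)) (fill-suc D x<h)

fill-adjacent : ∀ (D : Vec Sym n) {x} → x < stars D → Adj (fill x D) (fill (suc x) D)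
fill-adjacent D {x} x<h with fill-suc D x<h
... | p , step = subst (Adj (fill x D)) (sym step) (Adj-toggle p (fill x D))

lookup-fill-s0 : ∀ (D : Vec Sym n) {p x} → lookup D p ≡ s0 → lookup (fill x D) p ≡ false
lookup-fill-s0 (s0 ∷ D) {zero} refl = refl
lookup-fill-s0 (s0 ∷ D) {suc p} Dp = lookup-fill-s0 D Dp
lookup-fill-s0 (s1 ∷ D) {suc p} Dp = lookup-fill-s0 D Dp
lookup-fill-s0 (star ∷ D) {suc p} {zero} Dp = lookup-fill-s0 D Dp
lookup-fill-s0 (star ∷ D) {suc p} {suc x} Dp = lookup-fill-s0 D Dp

lookup-fill-s1 : ∀ (D : Vec Sym n) {p x} → lookup D p ≡ s1 → lookup (fill x D) p ≡ true
lookup-fill-s1 (s1 ∷ D) {zero} refl = refl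
lookup-fill-s1 (s0 ∷ D) {suc p} Dp = lookup-fill-s1 D Dp
lookup-fill-s1 (s1 ∷ D) {suc p} Dp = lookup-fill-s1 D Dp
lookup-fill-s1 (star ∷ D) {suc p} {zero} Dp = lookup-fill-s1 D Dp
lookup-fill-s1 (star ∷ D) {suc p} {suc x} Dp = lookup-fill-s1 D Dp

lookup-fill-star< : ∀ (D : Vec Sym n) {p x} → lookup D p ≡ star → starsBefore D p < x →
                    lookup (fill x D) p ≡ true
lookup-fill-star< (star ∷ D) {zero} refl (s≤s _) = refl
lookup-fill-star< (s0 ∷ D) {suc p} Dp r<x = lookup-fill-star< D Dp r<x
lookup-fill-star< (s1 ∷ D) {suc p} Dp r<x = lookup-fill-star< D Dp r<x
lookup-fill-star< (star ∷ D) {suc p} Dp (s≤s r<x) = lookup-fill-star< D Dp r<x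

lookup-fill-star≥ : ∀ (D : Vec Sym n) {p x} → lookup D p ≡ star → x ≤ starsBefore D p →
                    lookup (fill x D) p ≡ false
lookup-fill-star≥ (star ∷ D) {zero} refl z≤n = refl
lookup-fill-star≥ (s0 ∷ D) {suc p} Dp x≤r = lookup-fill-star≥ D Dp x≤r
lookup-fill-star≥ (s1 ∷ D) {suc p} Dp x≤r = lookup-fill-star≥ D Dp x≤r
lookup-fill-star≥ (star ∷ D) {suc p} {zero} Dp _ = lookup-fill-star≥ D Dp z≤n
lookup-fill-star≥ (star ∷ D) {suc p} {suc x} Dp (s≤s x≤r) = lookup-fill-star≥ D Dp x≤r

FlipsAt-star : ∀ (D : Vec Sym n) {q i} → lookup D q ≡ star → FlipsAt D i q ⇔ i ≡ starsBefore D q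
FlipsAt-star D {q} {i} Dq = mk⇔ to from
  where
  to : FlipsAt D i q → i ≡ starsBefore D q
  to flips with <-cmp i (starsBefore D q)
  ... | tri< i<r _ _ =
    ⊥-elim (flips (trans (lookup-fill-star≥ D Dq (<⇒≤ i<r)) (sym (lookup-fill-star≥ D Dq i<r))))
  ... | tri≈ _ i≡r _ = i≡r
  ... | tri> _ _ r<i =
    ⊥-elim (flips (trans (lookup-fill-star< D Dq r<i) (sym (lookup-fill-star< D Dq (m<n⇒m<1+n r<i)))))
  from : i ≡ starsBefore D q → FlipsAt D i q
  from i≡r same = not-¬ refl (trans (sym (lookup-fill-star≥ D Dq (≤-reflexive i≡r)))
                                    (trans same (lookup-fill-star< D Dq (s≤s (≤-reflexive (sym i≡r))))))

fill-set-s0-below : ∀ (D : Vec Sym n) {q y} → lookup D q ≡ star → y ≤ starsBefore D q →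
                    fill y (D [ q ]≔ s0) ≡ fill y D
fill-set-s0-below (star ∷ D) {zero} refl z≤n = refl
fill-set-s0-below (s0 ∷ D) {suc q} Dq y≤r = cong (false ∷_) (fill-set-s0-below D Dq y≤r)
fill-set-s0-below (s1 ∷ D) {suc q} Dq y≤r = cong (true ∷_) (fill-set-s0-below D Dq y≤r)
fill-set-s0-below (star ∷ D) {suc q} {zero} Dq _ = cong (false ∷_) (fill-set-s0-below D Dq z≤n)
fill-set-s0-below (star ∷ D) {suc q} {suc y} Dq (s≤s y≤r) = cong (true ∷_) (fill-set-s0-below D Dq y≤r)

fill-set-s0-above : ∀ (D : Vec Sym n) {q y} → lookup D q ≡ star → starsBefore D q ≤ y →
                    fill y (D [ q ]≔ s0) ≡ toggle q (fill (suc y) D)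
fill-set-s0-above (star ∷ D) {zero} refl _ = refl
fill-set-s0-above (s0 ∷ D) {suc q} Dq r≤y = cong (false ∷_) (fill-set-s0-above D Dq r≤y)
fill-set-s0-above (s1 ∷ D) {suc q} Dq r≤y = cong (true ∷_) (fill-set-s0-above D Dq r≤y)
fill-set-s0-above (star ∷ D) {suc q} {zero} Dq ()
fill-set-s0-above (star ∷ D) {suc q} {suc y} Dq (s≤s r≤y) = cong (true ∷_) (fill-set-s0-above D Dq r≤y)

fill-set-s1-below : ∀ (D : Vec Sym n) {q y} → lookup D q ≡ star → y ≤ starsBefore D q →
                    fill y (D [ q ]≔ s1) ≡ toggle q (fill y D)
fill-set-s1-below (star ∷ D) {zero} refl z≤n = refl
fill-set-s1-below (s0 ∷ D) {suc q} Dq y≤r = cong (false ∷_) (fill-set-s1-below D Dq y≤r)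
fill-set-s1-below (s1 ∷ D) {suc q} Dq y≤r = cong (true ∷_) (fill-set-s1-below D Dq y≤r)
fill-set-s1-below (star ∷ D) {suc q} {zero} Dq _ = cong (false ∷_) (fill-set-s1-below D Dq z≤n)
fill-set-s1-below (star ∷ D) {suc q} {suc y} Dq (s≤s y≤r) = cong (true ∷_) (fill-set-s1-below D Dq y≤r)

fill-set-s1-above : ∀ (D : Vec Sym n) {q y} → lookup D q ≡ star → starsBefore D q ≤ y →
                    fill y (D [ q ]≔ s1) ≡ fill (suc y) D
fill-set-s1-above (star ∷ D) {zero} refl _ = refl
fill-set-s1-above (s0 ∷ D) {suc q} Dq r≤y = cong (false ∷_) (fill-set-s1-above D Dq r≤y)
fill-set-s1-above (s1 ∷ D) {suc q} Dq r≤y = cong (true ∷_) (fill-set-s1-above D Dq r≤y)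
fill-set-s1-above (star ∷ D) {suc q} {zero} Dq ()
fill-set-s1-above (star ∷ D) {suc q} {suc y} Dq (s≤s r≤y) = cong (true ∷_) (fill-set-s1-above D Dq r≤y)

OnChain : Vec Sym n → Vertex n → Set
OnChain D u = ∃ λ x → u ≡ fill x D

SameEdge-path-ends : ∀ (D : Vec Sym n) {u v x} → SameEdge (u , v) (pathEdge D x) → OnChain D u × OnChain D v
SameEdge-path-ends D {x = x} (inj₁ (e₀ , e₁)) = (x , e₀) , (suc x , e₁)
SameEdge-path-ends D {x = x} (inj₂ (e₀ , e₁)) = (suc x , e₀) , (x , e₁)

SameEdge-path-injective : ∀ (D : Vec Sym n) {x y} → x < stars D → y < stars D →
                          SameEdge (pathEdge D x) (pathEdge D y) → x ≡ y
SameEdge-path-injective D x<h y<h (inj₁ (e , _)) = fill-injective D (<⇒≤ x<h) (<⇒≤ y<h) e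
SameEdge-path-injective D x<h y<h (inj₂ (e₀ , e₁)) =
  ⊥-elim (<-asym (≤-reflexive (fill-injective D x<h (<⇒≤ y<h) e₁))
                 (≤-reflexive (sym (fill-injective D (<⇒≤ x<h) y<h e₀))))

module Chains (C C' : Vec Sym n) where

  P Q : ℕ → Vertex n
  P x = fill x C
  Q y = fill y C'

  corners : ℕ → ℕ → Fin 4 → Vertex n
  corners i m = quad (P i) (P (suc i)) (Q (suc m)) (Q m)

  data SquareOn (f : Fin 4 → Vertex n) (i m : ℕ) : Set where
    straight : Adj (P i) (Q m) → Adj (P (suc i)) (Q (suc m)) → SameEdges f (corners i m) → SquareOn f i m
    crossed  : Adj (P (suc i)) (Q m) → Adj (P i) (Q (suc m)) → SquareOn f i m

  SquareOn-resp : ∀ {f g i m} → SameEdges f g → SquareOn g i m → SquareOn f i m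
  SquareOn-resp f≈g (straight A₀ A₁ g≈corners) = straight A₀ A₁ (SameEdges-trans f≈g g≈corners)
  SquareOn-resp f≈g (crossed A₀ A₁) = crossed A₀ A₁

  module Disjoint (disjoint : ∀ x y → P x ≢ Q y) where

    not-on-both : ∀ {u} → OnChain C u → OnChain C' u → ⊥
    not-on-both (x , refl) (y , e) = disjoint x y e

    module Square {i m} (i<h : i < stars C) (m<h′ : m < stars C')
                  (rung₀ : Adj (P i) (Q m)) (rung₁ : Adj (P (suc i)) (Q (suc m))) where

      cycle : Cycle4 n
      cycle = record { vtx = corners i m ; distinct = corners-distinct ; adj = corners-adjacent }
        where
        corners-distinct : ∀ r s → corners i m r ≡ corners i m s → r ≡ s
        corners-distinct = quad-injective (1+n≢n ∘ sym ∘ fill-injective C (<⇒≤ i<h) i<h)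
                                  (disjoint i (suc m)) (disjoint i m)
                                  (disjoint (suc i) (suc m)) (disjoint (suc i) m)
                                  (1+n≢n ∘ fill-injective C' m<h′ (<⇒≤ m<h′))
        corners-adjacent : ∀ r → Adj (corners i m r) (corners i m (next4 r))
        corners-adjacent 0F = fill-adjacent C i<h
        corners-adjacent 1F = rung₁
        corners-adjacent 2F = Adj-sym {u = Q m} {Q (suc m)} (fill-adjacent C' m<h′)
        corners-adjacent 3F = Adj-sym {u = P i} {Q m} rung₀

      on-C : ∀ {k x} → SameEdge (cycEdge cycle k) (pathEdge C x) → k ≡ 0F
      on-C {0F} _ = refl
      on-C {1F} e = ⊥-elim (not-on-both (proj₂ (SameEdge-path-ends C e)) (suc m , refl))
      on-C {2F} e = ⊥-elim (not-on-both (proj₁ (SameEdge-path-ends C e)) (suc m , refl))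
      on-C {3F} e = ⊥-elim (not-on-both (proj₁ (SameEdge-path-ends C e)) (m , refl))

      on-C' : ∀ {k y} → SameEdge (cycEdge cycle k) (pathEdge C' y) → k ≡ 2F
      on-C' {0F} e = ⊥-elim (not-on-both (i , refl) (proj₁ (SameEdge-path-ends C' e)))
      on-C' {1F} e = ⊥-elim (not-on-both (suc i , refl) (proj₁ (SameEdge-path-ends C' e)))
      on-C' {2F} _ = refl
      on-C' {3F} e = ⊥-elim (not-on-both (i , refl) (proj₂ (SameEdge-path-ends C' e)))

      flipping : Flipping C C' cycle
      flipping = (0F , (i , i<h , SameEdge-refl) , λ _ (_ , _ , e) → on-C e)
               , (2F , (m , m<h′ , SameEdge-swap) , λ _ (_ , _ , e) → on-C' e)

      uses-C-edge : UsesEdge C cycle i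
      uses-C-edge = i<h , 0F , SameEdge-refl

      uses-C : ∀ {x} → UsesEdge C cycle x → x ≡ i
      uses-C (x<h , k , e) with on-C e
      ... | refl = sym (SameEdge-path-injective C i<h x<h e)

      uses-C' : ∀ {y} → UsesEdge C' cycle y → y ≡ m
      uses-C' (y<h′ , k , e) with on-C' e
      ... | refl = sym (SameEdge-path-injective C' m<h′ y<h′ (SameEdge-trans SameEdge-swap e))

    opposite-edges : ∀ {u₀ u₁ u₂ u₃} {i m} →
                     SameEdge (u₀ , u₁) (pathEdge C i) → SameEdge (u₂ , u₃) (pathEdge C' m) →
                     Adj u₀ u₃ → Adj u₁ u₂ → SquareOn (quad u₀ u₁ u₂ u₃) i m
    opposite-edges (inj₁ (refl , refl)) (inj₂ (refl , refl)) A₀₃ A₁₂ = straight A₀₃ A₁₂ SameEdges-refl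
    opposite-edges (inj₂ (refl , refl)) (inj₁ (refl , refl)) A₀₃ A₁₂ = straight A₁₂ A₀₃ SameEdges-reverse
    opposite-edges (inj₁ (refl , refl)) (inj₁ (refl , refl)) A₀₃ A₁₂ = crossed A₁₂ A₀₃
    opposite-edges (inj₂ (refl , refl)) (inj₂ (refl , refl)) A₀₃ A₁₂ = crossed A₀₃ A₁₂

    flipping-shape : ∀ W → Flipping C C' W →
                     ∃ λ i → ∃ λ m → i < stars C × m < stars C' × SquareOn (vtx W) i m
    flipping-shape W ((k , (i , i<h , e) , _) , (k′ , (m , m<h′ , e′) , _))
      with edges-adjacent-or-opposite k k′
    ... | inj₁ refl =
      ⊥-elim (not-on-both (proj₁ (SameEdge-path-ends C e)) (proj₁ (SameEdge-path-ends C' e′)))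
    ... | inj₂ (inj₁ refl) =
      ⊥-elim (not-on-both (proj₂ (SameEdge-path-ends C e)) (proj₁ (SameEdge-path-ends C' e′)))
    ... | inj₂ (inj₂ (inj₁ refl)) =
      ⊥-elim (not-on-both (proj₁ (SameEdge-path-ends C e)) (proj₂ (SameEdge-path-ends C' e′)))
    ... | inj₂ (inj₂ (inj₂ refl)) =
      i , m , i<h , m<h′ ,
      SquareOn-resp (SameEdges-startAt (vtx W) k) (opposite-edges e e′ A₀₃ (adj W (next4 k)))
      where
      k₃ = next4 (next4 (next4 k))
      A₀₃ : Adj (vtx W k) (vtx W k₃)
      A₀₃ = Adj-sym {u = vtx W k₃} {vtx W k}
              (subst (Adj (vtx W k₃)) (cong (vtx W) (next4-period k)) (adj W k₃))

module Child (C C' : Vec Sym n) (a b : Fin n)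
    (a<b : a <ᶠ b) (C-a : lookup C a ≡ star) (C-b : lookup C b ≡ star)
    (no-star-between : ∀ k → a <ᶠ k → k <ᶠ b → lookup C k ≢ star)
    (C'-a : lookup C' a ≡ s0) (C'-b : lookup C' b ≡ s1)
    (C'-elsewhere : ∀ k → k ≢ a → k ≢ b → lookup C' k ≡ lookup C k) where

  open Chains C C'

  C₀ : Vec Sym n
  C₀ = C [ a ]≔ s0

  C'-≡ : C' ≡ C₀ [ b ]≔ s1
  C'-≡ = lookup-ext pointwise
    where
    pointwise : ∀ p → lookup C' p ≡ lookup (C₀ [ b ]≔ s1) p
    pointwise p with p Fin.≟ b | p Fin.≟ a
    ... | yes refl | _ = trans C'-b (sym (lookup∘update p C₀ s1))
    ... | no p≢b | yes refl =
      trans C'-a (sym (trans (lookup∘update′ p≢b C₀ s1) (lookup∘update p C s0)))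
    ... | no p≢b | no p≢a =
      trans (C'-elsewhere p p≢a p≢b) (sym (trans (lookup∘update′ p≢b C₀ s1) (lookup∘update′ p≢a C s0)))

  C₀-b : lookup C₀ b ≡ star
  C₀-b = trans (lookup∘update′ (Fin.<⇒≢ a<b ∘ sym) C s0) C-b

  j : ℕ
  j = starsBefore C a

  starsBefore-b : starsBefore C b ≡ suc j
  starsBefore-b = starsBefore-consecutive C a<b C-a no-star-between

  starsBefore-C₀-b : starsBefore C₀ b ≡ j
  starsBefore-C₀-b = suc-injective (trans (sym (starsBefore-set C a<b C-a λ ())) starsBefore-b)

  stars-C : stars C ≡ suc (suc (stars C'))
  stars-C = begin
    stars C                          ≡⟨ stars-set C C-a (λ ()) ⟩
    suc (stars C₀)                   ≡⟨ cong suc (stars-set C₀ C₀-b (λ ())) ⟩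
    suc (suc (stars (C₀ [ b ]≔ s1))) ≡⟨ cong (λ D → suc (suc (stars D))) C'-≡ ⟨
    suc (suc (stars C'))             ∎
    where open ≡-Reasoning

  ≤stars-C' : ∀ {x} → suc (suc x) ≤ stars C → x ≤ stars C'
  ≤stars-C' le = ≤-pred (≤-pred (subst (_ ≤_) stars-C le))

  j≤stars-C' : j ≤ stars C'
  j≤stars-C' = ≤stars-C' (subst (λ r → suc r ≤ stars C) starsBefore-b (starsBefore<stars C C-b))

  Q-below : ∀ {y} → y ≤ j → Q y ≡ toggle b (P y)
  Q-below {y} y≤j = begin
    Q y                   ≡⟨ cong (fill y) C'-≡ ⟩
    fill y (C₀ [ b ]≔ s1) ≡⟨ fill-set-s1-below C₀ C₀-b (subst (y ≤_) (sym starsBefore-C₀-b) y≤j) ⟩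
    toggle b (fill y C₀)  ≡⟨ cong (toggle b) (fill-set-s0-below C C-a y≤j) ⟩
    toggle b (P y)        ∎
    where open ≡-Reasoning

  Q-above : ∀ {y} → j ≤ y → Q y ≡ toggle a (P (suc (suc y)))
  Q-above {y} j≤y = begin
    Q y                        ≡⟨ cong (fill y) C'-≡ ⟩
    fill y (C₀ [ b ]≔ s1)      ≡⟨ fill-set-s1-above C₀ C₀-b (subst (_≤ y) (sym starsBefore-C₀-b) j≤y) ⟩
    fill (suc y) C₀            ≡⟨ fill-set-s0-above C C-a (m≤n⇒m≤1+n j≤y) ⟩
    toggle a (P (suc (suc y))) ∎
    where open ≡-Reasoning

  differ-a : ∀ {x y} → j < x → lookup (P x) a ≢ lookup (Q y) a
  differ-a j<x same =
    not-¬ refl (trans (sym (lookup-fill-star< C C-a j<x)) (trans same (lookup-fill-s0 C' C'-a)))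

  differ-b : ∀ {x y} → x ≤ suc j → lookup (P x) b ≢ lookup (Q y) b
  differ-b x≤j+1 same =
    not-¬ refl (trans (sym (lookup-fill-star≥ C C-b (subst (_ ≤_) (sym starsBefore-b) x≤j+1)))
                      (trans same (lookup-fill-s1 C' C'-b)))

  disjoint : ∀ x y → P x ≢ Q y
  disjoint x y same with x ≤? j
  ... | yes x≤j = differ-b (m≤n⇒m≤1+n x≤j) (cong (λ v → lookup v b) same)
  ... | no x≰j = differ-a (≰⇒> x≰j) (cong (λ v → lookup v a) same)

  data Rung : ℕ → ℕ → Set where
    rung-below : ∀ {x} → x ≤ j → Rung x x
    rung-above : ∀ {y} → j ≤ y → Rung (suc (suc y)) y

  Rung⇒Adj : ∀ {x y} → Rung x y → Adj (P x) (Q y)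
  Rung⇒Adj (rung-below {x} x≤j) = subst (Adj (P x)) (sym (Q-below x≤j)) (Adj-toggle b (P x))
  Rung⇒Adj (rung-above {y} j≤y) =
    subst (Adj (P (suc (suc y)))) (sym (Q-above j≤y)) (Adj-toggle a (P (suc (suc y))))

  Adj⇒Rung : ∀ {x y} → x ≤ stars C → y ≤ stars C' → Adj (P x) (Q y) → Rung x y
  Adj⇒Rung {x} {y} x≤h y≤h′ A with <-cmp x (suc j)
  ... | tri< x<j+1 _ _ = subst (Rung x) (sym y≡x) (rung-below x≤j)
    where
    x≤j : x ≤ j
    x≤j = ≤-pred x<j+1
    y≡x : y ≡ x
    y≡x = fill-injective C' y≤h′ (≤-trans x≤j j≤stars-C')
            (trans (Adj⇒toggle b A (differ-b (<⇒≤ x<j+1))) (sym (Q-below x≤j)))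
  ... | tri≈ _ x≡j+1 _ =
    ⊥-elim (Fin.<⇒≢ a<b (Adj-coordinate-unique {u = P x} {Q y} A
                           (differ-a (≤-reflexive (sym x≡j+1))) (differ-b (≤-reflexive x≡j+1))))
  ... | tri> _ _ (s≤s (s≤s {n = x′} j≤x′)) = subst (Rung (suc (suc x′))) (sym y≡x′) (rung-above j≤x′)
    where
    y≡x′ : y ≡ x′
    y≡x′ = fill-injective C' y≤h′ (≤stars-C' x≤h)
             (trans (Adj⇒toggle a A (differ-a (s≤s (m≤n⇒m≤1+n j≤x′)))) (sym (Q-above j≤x′)))

  ¬crossed : ∀ {i m} → Rung (suc i) m → Rung i (suc m) → ⊥
  ¬crossed (rung-above j≤m) (rung-below m<j) = <⇒≱ m<j j≤m

  -- Edge m of C' and edge i of C are opposite sides of a flipping 4-cycle.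
  data Facing (m : ℕ) : ℕ → Set where
    facing-below : m < j → Facing m m
    facing-above : j ≤ m → Facing m (suc (suc m))

  facing : ∀ m → ∃ (Facing m)
  facing m with m <? j
  ... | yes m<j = m , facing-below m<j
  ... | no m≮j = suc (suc m) , facing-above (≮⇒≥ m≮j)

  opposite : ℕ → ℕ
  opposite m = proj₁ (facing m)

  facing-opposite : ∀ m → Facing m (opposite m)
  facing-opposite m = proj₂ (facing m)

  Facing⇒Rungs : ∀ {m i} → Facing m i → Rung i m × Rung (suc i) (suc m)
  Facing⇒Rungs (facing-below m<j) = rung-below (<⇒≤ m<j) , rung-below m<j
  Facing⇒Rungs (facing-above j≤m) = rung-above j≤m , rung-above (m≤n⇒m≤1+n j≤m)

  Rungs⇒Facing : ∀ {m i} → Rung i m → Rung (suc i) (suc m) → Facing m i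
  Rungs⇒Facing (rung-below _) (rung-below m<j) = facing-below m<j
  Rungs⇒Facing (rung-above j≤m) (rung-above _) = facing-above j≤m

  facing-unique : ∀ {m i i′} → Facing m i → Facing m i′ → i ≡ i′
  facing-unique (facing-below _) (facing-below _) = refl
  facing-unique (facing-below m<j) (facing-above j≤m) = ⊥-elim (<⇒≱ m<j j≤m)
  facing-unique (facing-above j≤m) (facing-below m<j) = ⊥-elim (<⇒≱ m<j j≤m)
  facing-unique (facing-above _) (facing-above _) = refl

  facing-injective : ∀ {m m′ i} → Facing m i → Facing m′ i → m ≡ m′
  facing-injective (facing-below _) (facing-below _) = refl
  facing-injective (facing-below m+2<j) (facing-above j≤m) =
    ⊥-elim (<⇒≱ (<-trans (m<n⇒m<1+n (n<1+n _)) m+2<j) j≤m)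
  facing-injective (facing-above j≤m) (facing-below m+2<j) =
    ⊥-elim (<⇒≱ (<-trans (m<n⇒m<1+n (n<1+n _)) m+2<j) j≤m)
  facing-injective (facing-above _) (facing-above _) = refl

  opposite-injective : ∀ {m m′} → opposite m ≡ opposite m′ → m ≡ m′
  opposite-injective {m} {m′} same =
    facing-injective (facing-opposite m) (subst (Facing m′) (sym same) (facing-opposite m′))

  facing-bound : ∀ {m i} → Facing m i → m < stars C' → i < stars C
  facing-bound (facing-below _) m<h′ =
    ≤-trans m<h′ (subst (stars C' ≤_) (sym stars-C) (m≤n⇒m≤1+n (n≤1+n _)))
  facing-bound (facing-above _) m<h′ = subst (_ <_) (sym stars-C) (s≤s (s≤s m<h′))

  FlipsAt-a : ∀ {i} → FlipsAt C i a ⇔ i ≡ j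
  FlipsAt-a = FlipsAt-star C C-a

  FlipsAt-b : ∀ {i} → FlipsAt C i b ⇔ i ≡ suc j
  FlipsAt-b {i} = subst (λ r → FlipsAt C i b ⇔ i ≡ r) starsBefore-b (FlipsAt-star C C-b)

  facing⇒no-flips : ∀ {m i} → Facing m i → ¬ FlipsAt C i a × ¬ FlipsAt C i b
  facing⇒no-flips {i = i} f = avoid-j f ∘ Equivalence.to FlipsAt-a , avoid-j+1 f ∘ Equivalence.to FlipsAt-b
    where
    avoid-j : ∀ {m} → Facing m i → i ≢ j
    avoid-j (facing-below m<j) = <⇒≢ m<j
    avoid-j (facing-above j≤m) = >⇒≢ (s≤s (m≤n⇒m≤1+n j≤m))
    avoid-j+1 : ∀ {m} → Facing m i → i ≢ suc j
    avoid-j+1 (facing-below m<j) = <⇒≢ (m<n⇒m<1+n m<j)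
    avoid-j+1 (facing-above j≤m) = >⇒≢ (s≤s (s≤s j≤m))

  no-flips⇒facing : ∀ {i} → i < stars C → ¬ FlipsAt C i a × ¬ FlipsAt C i b →
                    ∃ λ m → m < stars C' × Facing m i
  no-flips⇒facing {i} i<h (¬flips-a , ¬flips-b) with <-cmp i j
  ... | tri< i<j _ _ = i , ≤-trans i<j j≤stars-C' , facing-below i<j
  ... | tri≈ _ i≡j _ = ⊥-elim (¬flips-a (Equivalence.from FlipsAt-a i≡j))
  ... | tri> _ _ j<i with ≤∧≢⇒< j<i (¬flips-b ∘ Equivalence.from FlipsAt-b ∘ sym)
  ...   | s≤s (s≤s {n = m} j≤m) = m , ≤stars-C' i<h , facing-above j≤m

  open Disjoint disjoint

  stars-C∸2 : stars C ∸ 2 ≡ stars C'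
  stars-C∸2 = cong (_∸ 2) stars-C

  toℕ<stars-C' : (t : Fin (stars C ∸ 2)) → toℕ t < stars C'
  toℕ<stars-C' t = subst (toℕ t <_) stars-C∸2 (Fin.toℕ<n t)

  fromEdge : ∀ {m} → m < stars C' → Fin (stars C ∸ 2)
  fromEdge m<h′ = fromℕ< (subst (_ <_) (sym stars-C∸2) m<h′)

  toℕ-fromEdge : ∀ {m} (m<h′ : m < stars C') → toℕ (fromEdge m<h′) ≡ m
  toℕ-fromEdge m<h′ = Fin.toℕ-fromℕ< _

  module FlippingCycle (t : Fin (stars C ∸ 2)) =
    Square (facing-bound (facing-opposite (toℕ t)) (toℕ<stars-C' t)) (toℕ<stars-C' t)
           (Rung⇒Adj (proj₁ (Facing⇒Rungs (facing-opposite (toℕ t)))))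
           (Rung⇒Adj (proj₂ (Facing⇒Rungs (facing-opposite (toℕ t)))))

  flippingCycle : Fin (stars C ∸ 2) → Cycle4 n
  flippingCycle = FlippingCycle.cycle

  flippingCycle-flipping : ∀ t → Flipping C C' (flippingCycle t)
  flippingCycle-flipping = FlippingCycle.flipping

  C-edge-unique : ∀ t t′ i → UsesEdge C (flippingCycle t) i → UsesEdge C (flippingCycle t′) i → t ≡ t′
  C-edge-unique t t′ i uses uses′ =
    Fin.toℕ-injective (opposite-injective
      (trans (sym (FlippingCycle.uses-C t uses)) (FlippingCycle.uses-C t′ uses′)))

  C'-edge-unique : ∀ t t′ y → UsesEdge C' (flippingCycle t) y → UsesEdge C' (flippingCycle t′) y → t ≡ t′
  C'-edge-unique t t′ y uses uses′ =
    Fin.toℕ-injective (trans (sym (FlippingCycle.uses-C' t uses)) (FlippingCycle.uses-C' t′ uses′))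

  flippingCycle-injective : ∀ t t′ → SameCycle (flippingCycle t) (flippingCycle t′) → t ≡ t′
  flippingCycle-injective t t′ (edges⊆ , _) with edges⊆ 0F
  ... | k , same = C-edge-unique t t′ _ own-edge (proj₁ own-edge , k , SameEdge-sym same)
    where own-edge = FlippingCycle.uses-C-edge t

  flippingCycle-complete : ∀ W → Flipping C C' W → ∃ λ t → SameCycle W (flippingCycle t)
  flippingCycle-complete W flips with flipping-shape W flips
  ... | i , m , i<h , m<h′ , crossed A₀ A₁ =
    ⊥-elim (¬crossed (Adj⇒Rung i<h (<⇒≤ m<h′) A₀) (Adj⇒Rung (<⇒≤ i<h) m<h′ A₁))
  ... | i , m , i<h , m<h′ , straight A₀ A₁ same =
    fromEdge m<h′ ,
    subst (λ m → SameEdges (vtx W) (corners (opposite m) m)) (sym (toℕ-fromEdge m<h′))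
          (subst (λ i → SameEdges (vtx W) (corners i m)) i≡opposite same)
    where
    i≡opposite : i ≡ opposite m
    i≡opposite = facing-unique (Rungs⇒Facing (Adj⇒Rung (<⇒≤ i<h) (<⇒≤ m<h′) A₀)
                                             (Adj⇒Rung i<h m<h′ A₁))
                               (facing-opposite m)

  C-edges-used : ∀ i → i < stars C →
                 (∃ λ t → UsesEdge C (flippingCycle t) i) ⇔ (¬ FlipsAt C i a × ¬ FlipsAt C i b)
  C-edges-used i i<h = mk⇔ to from
    where
    to : (∃ λ t → UsesEdge C (flippingCycle t) i) → ¬ FlipsAt C i a × ¬ FlipsAt C i b
    to (t , uses) = subst (λ x → ¬ FlipsAt C x a × ¬ FlipsAt C x b) (sym (FlippingCycle.uses-C t uses))
                          (facing⇒no-flips (facing-opposite (toℕ t)))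
    from : ¬ FlipsAt C i a × ¬ FlipsAt C i b → ∃ λ t → UsesEdge C (flippingCycle t) i
    from no-flips with no-flips⇒facing i<h no-flips
    ... | m , m<h′ , facing-i =
      t , subst (UsesEdge C (flippingCycle t)) opposite≡i (FlippingCycle.uses-C-edge t)
      where
      t = fromEdge m<h′
      opposite≡i : opposite (toℕ t) ≡ i
      opposite≡i = facing-unique (facing-opposite (toℕ t))
                                 (subst (λ m → Facing m i) (sym (toℕ-fromEdge m<h′)) facing-i)

lemma12 : ∀ {n} (C C' : Vec Sym n) (a b : Fin n) → IsGK C → IsChild C C' a b →
    Σ (Fin (stars C ∸ 2) → Cycle4 n) λ Z →
      (∀ t → Flipping C C' (Z t)) ×
      (∀ t t' → SameCycle (Z t) (Z t') → t ≡ t') ×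
      (∀ W → Flipping C C' W → ∃ λ t → SameCycle W (Z t)) ×
      (∀ t t' i → UsesEdge C (Z t) i → UsesEdge C (Z t') i → t ≡ t') ×
      (∀ t t' i → UsesEdge C' (Z t) i → UsesEdge C' (Z t') i → t ≡ t') ×
      (∀ i → i < stars C →
        ((∃ λ t → UsesEdge C (Z t) i) ⇔ (¬ FlipsAt C i a × ¬ FlipsAt C i b)))
lemma12 C C' a b _ (a<b , C-a , C-b , no-star-between , C'-a , C'-b , C'-elsewhere) =
  flippingCycle , flippingCycle-flipping , flippingCycle-injective , flippingCycle-complete ,
  C-edge-unique , C'-edge-unique , C-edges-used
  where open Child C C' a b a<b C-a C-b no-star-between C'-a C'-b C'-elsewhere
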